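{- Let $\mathbb{F}$ be a field and $R=\mathbb{F}[x_1,\dots,x_n]/K$ a finite-dimensional $\mathbb{F}$-algebra, where $K$ is a Borel stable monomial ideal. Then the set $\Lambda=\{\lambda\in\mathbb{Z}_{\ge0}^n: x_1^{\lambda_1}\cdots x_n^{\lambda_n}\notin K\}$ of exponent vectors of standard monomials of $R$ has the Borel Exchange Property.
   Context: The Borel group $\mathcal{B}(n,\mathbb{F})$ is the group of invertible upper-triangular $n\times n$ matrices, acting on polynomials by ${}^gf(x)=f(xg)$ with $x=(x_1,\dots,x_n)$ a row vector; ${}^gK$ is the ideal generated by $\{{}^gf: f\in K\}$. $K$ is Borel stable if ${}^gK=K$ for all $g\in\mathcal{B}(n,\mathbb{F})$. Let $\hat e_i$ be the $i$-th standard basis vector. A set $\Lambda\subseteq\mathbb{Z}_{\ge0}^n$ has the Borel Exchange Property if for all $1\le j<i\le n$ and every $\lambda\in\Lambda$ with $\lambda_i=0$, the points $\lambda+l(\hat e_i-\hat e_j)$ lie in $\Lambda$ for all integers $0\le l\le\lambda_j$. -}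

module Defs where

open import Level using (Level; _⊔_; 0ℓ)
open import Algebra.Bundles using (CommutativeRing)
open import Data.Nat as ℕ using (ℕ; zero; suc; _∸_)
open import Data.Fin as Fin using (Fin)
open import Data.Vec as Vec using (Vec; lookup; updateAt; replicate; zipWith; tabulate)
open import Data.Vec.Properties using (≡-dec)
open import Data.List as List using (List; []; _∷_; _++_; concatMap; map; foldr; allFin)
open import Data.Product using (Σ; ∃; _×_; _,_; proj₁; proj₂)
open import Relation.Nullary using (¬_; Dec; yes; no)
open import Relation.Binary.PropositionalEquality using (_≡_)
open import Data.List.Membership.Propositional using (_∈_)

record Field (c ℓ : Level) : Set (Level.suc (c ⊔ ℓ)) where
  field
    commutativeRing : CommutativeRing c ℓ
  open CommutativeRing commutativeRing public
  field
    1≉0     : ¬ (1# ≈ 0#)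
    inverse : ∀ x → ¬ (x ≈ 0#) → ∃ λ y → x * y ≈ 1#

Exp : ℕ → Set
Exp n = Vec ℕ n

-- standard basis-vector shift: λ + l (ê_i - ê_j), written with natural
-- subtraction (only used when l ≤ λ_j, so ∸ is exact subtraction).
shift : ∀ {n} → Exp n → (i j : Fin n) → ℕ → Exp n
shift λ' i j l = updateAt (updateAt λ' j (λ a → a ∸ l)) i (λ a → a ℕ.+ l)

BorelExchange : ∀ {p} (n : ℕ) → (Exp n → Set p) → Set p
BorelExchange n Λ =
  ∀ (j i : Fin n) → j Fin.< i →
  ∀ (λ' : Exp n) → Λ λ' → lookup λ' i ≡ 0 →
  ∀ (l : ℕ) → l ℕ.≤ lookup λ' j → Λ (shift λ' i j l)

-- Polynomials in x₁,…,xₙ over a field, represented as finite formal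
-- sums of terms c · x^α; two representations are equal when all their
-- coefficients agree.

module Poly {c ℓ} (F : Field c ℓ) (n : ℕ) where
  open Field F

  Poly : Set c
  Poly = List (Carrier × Exp n)

  coeff : Poly → Exp n → Carrier
  coeff [] α = 0#
  coeff ((a , β) ∷ p) α with ≡-dec ℕ._≟_ β α
  ... | yes _ = a + coeff p α
  ... | no  _ = coeff p α

  _≋_ : Poly → Poly → Set ℓ
  p ≋ q = ∀ α → coeff p α ≈ coeff q α

  zeroP : Poly
  zeroP = []

  const : Carrier → Poly
  const a = (a , replicate n 0) ∷ []

  monomial : Exp n → Poly
  monomial α = (1# , α) ∷ []

  var : Fin n → Poly
  var m = monomial (updateAt (replicate n 0) m (λ _ → 1))

  _⊕_ : Poly → Poly → Poly
  p ⊕ q = p ++ q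

  _⊗_ : Poly → Poly → Poly
  p ⊗ q = concatMap (λ t → map (λ u → (proj₁ t * proj₁ u , zipWith ℕ._+_ (proj₂ t) (proj₂ u))) q) p

  scale : Carrier → Poly → Poly
  scale a p = map (λ t → (a * proj₁ t , proj₂ t)) p

  _^ᵖ_ : Poly → ℕ → Poly
  p ^ᵖ zero  = const 1#
  p ^ᵖ suc k = p ⊗ (p ^ᵖ k)

  sumP : List Poly → Poly
  sumP = foldr _⊕_ zeroP

  prodP : List Poly → Poly
  prodP = foldr _⊗_ (const 1#)

  Matrix : Set c
  Matrix = Fin n → Fin n → Carrier

  _·ᴹ_ : Matrix → Matrix → Matrix
  (g ·ᴹ h) a b = foldr _+_ 0# (map (λ k → g a k * h k b) (allFin n))

  identity : Matrix
  identity a b with a Fin.≟ b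
  ... | yes _ = 1#
  ... | no  _ = 0#

  _≈ᴹ_ : Matrix → Matrix → Set ℓ
  g ≈ᴹ h = ∀ a b → g a b ≈ h a b

  Invertible : Matrix → Set (c ⊔ ℓ)
  Invertible g = ∃ λ h → ((g ·ᴹ h) ≈ᴹ identity) × ((h ·ᴹ g) ≈ᴹ identity)

  UpperTriangular : Matrix → Set ℓ
  UpperTriangular g = ∀ a b → b Fin.< a → g a b ≈ 0#

  IsBorel : Matrix → Set (c ⊔ ℓ)
  IsBorel g = UpperTriangular g × Invertible g

  xg : Matrix → Fin n → Poly
  xg g k = sumP (map (λ m → scale (g m k) (var m)) (allFin n))

  -- ᵍf(x) = f(x g)
  act : Matrix → Poly → Poly
  act g f = sumP (map (λ t → scale (proj₁ t)
                      (prodP (map (λ k → xg g k ^ᵖ lookup (proj₂ t) k) (allFin n)))) f)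

  InIdeal : ∀ {g} → (Poly → Set g) → Poly → Set (c ⊔ ℓ ⊔ g)
  InIdeal {g} G p =
    Σ (List (Poly × Σ Poly G)) λ combo →
      p ≋ sumP (map (λ t → proj₁ t ⊗ proj₁ (proj₂ t)) combo)

  MonomialIdeal : ∀ {s} → (Exp n → Set s) → Poly → Set (c ⊔ ℓ ⊔ s)
  MonomialIdeal S = InIdeal (λ f → Σ (Exp n) λ α → S α × (f ≡ monomial α))

  actIdeal : ∀ {k} → Matrix → (Poly → Set k) → Poly → Set (c ⊔ ℓ ⊔ k)
  actIdeal g K = InIdeal (λ f → Σ Poly λ h → K h × (f ≡ act g h))

  BorelStable : ∀ {k} → (Poly → Set k) → Set (c ⊔ ℓ ⊔ k)
  BorelStable K = ∀ g → IsBorel g → ∀ p →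
    (actIdeal g K p → K p) × (K p → actIdeal g K p)

  -- F[x]/K is finite-dimensional over F: there is a finite family
  -- b₁,…,b_m whose classes span the quotient, i.e. every p is congruent
  -- modulo K to an F-linear combination of the b's.
  FiniteDimQuotient : ∀ {k} → (Poly → Set k) → Set (c ⊔ k)
  FiniteDimQuotient K =
    Σ (List Poly) λ bs → ∀ p → Σ (List (Carrier × Σ Poly λ b → b ∈ bs)) λ cs →
      K (p ⊕ scale (- 1#) (sumP (map (λ t → scale (proj₁ t) (proj₁ (proj₂ t))) cs)))

module Submission where

-- Suppose x^μ ∈ K. The transvection T = I + E_{ji} (x_i ↦ x_i + x_j) is
-- upper triangular and invertible, so Borel stability gives ᵀ(x^μ) ∈ K.
-- On the face α_i = 0 the polynomial ᵀ(x^μ) coincides with the single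
-- monomial x^ν, where ν moves the whole exponent of x_i onto x_j; for our μ
-- this ν is λ, so ᵀ(x^μ) has coefficient 1 at λ. But every element of a
-- monomial ideal has coefficient 0 at a standard exponent, and 1 ≠ 0.

open import Defs
open import Level using (Level)
open import Algebra.Bundles using (CommutativeMonoid)
open import Data.Nat as ℕ using (ℕ; zero; suc; pred)
import Data.Nat.Properties as ℕP
open import Data.Fin as Fin using (Fin; zero; suc)
import Data.Fin.Properties as FinP
open import Data.Vec as Vec using (lookup; updateAt; replicate; zipWith)
open import Data.Vec.Properties
  using (≡-dec; lookup∘updateAt; lookup∘updateAt′; updateAt-updateAt; updateAt-id;
         updateAt-id-local; lookup-replicate; zipWith-identityˡ; zipWith-assoc;
         tabulate∘lookup; tabulate-cong)
open import Data.List as List using (List; []; _∷_; _++_; map; foldr; allFin)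
open import Data.List.Properties using (map-++; ++-assoc; map-tabulate)
open import Data.Product using (_×_; _,_; proj₁; proj₂)
open import Relation.Nullary using (¬_; Dec; yes; no)
open import Relation.Binary.PropositionalEquality as ≡ using (_≡_; _≢_)
open import Data.Empty using (⊥-elim)
open import Function using (_∘_; id)

module FiniteSums {a b} (M : CommutativeMonoid a b) where
  open CommutativeMonoid M
  open import Algebra.Properties.CommutativeMonoid.Sum M public
    using (sum)
  open import Algebra.Properties.CommutativeMonoid.Sum M
    using (sum-cong-≋; sum-replicate-zero)

  foldr-allFin : ∀ {n} (f : Fin n → Carrier) → foldr _∙_ ε (map f (allFin n)) ≡ sum f
  foldr-allFin f = ≡.trans (≡.cong (foldr _∙_ ε) (map-tabulate id f)) (foldr-tabulate f)
    where
    foldr-tabulate : ∀ {n} (f : Fin n → Carrier) → foldr _∙_ ε (List.tabulate f) ≡ sum f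
    foldr-tabulate {zero}  f = ≡.refl
    foldr-tabulate {suc n} f = ≡.cong (f zero ∙_) (foldr-tabulate (f ∘ suc))

  sum-zero : ∀ {n} (f : Fin n → Carrier) → (∀ m → f m ≈ ε) → sum f ≈ ε
  sum-zero {n} f f≈ε = trans (sum-cong-≋ f≈ε) (sum-replicate-zero n)

  sum-single : ∀ {n} (f : Fin n → Carrier) (p : Fin n) →
               (∀ m → m ≢ p → f m ≈ ε) → sum f ≈ f p
  sum-single f zero off =
    trans (∙-cong refl (sum-zero (f ∘ suc) (λ m → off (suc m) λ ()))) (identityʳ _)
  sum-single f (suc p) off =
    trans (∙-cong (off zero λ ())
                  (sum-single (f ∘ suc) p (λ m m≢p → off (suc m) (m≢p ∘ FinP.suc-injective))))
          (identityˡ _)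

  sum-pair : ∀ {n} (f : Fin n → Carrier) (p q : Fin n) → p ≢ q →
             (∀ m → m ≢ p → m ≢ q → f m ≈ ε) → sum f ≈ f p ∙ f q
  sum-pair f zero    zero    p≢q off = ⊥-elim (p≢q ≡.refl)
  sum-pair f zero    (suc q) p≢q off =
    ∙-cong refl (sum-single (f ∘ suc) q (λ m m≢q → off (suc m) (λ ()) (m≢q ∘ FinP.suc-injective)))
  sum-pair f (suc p) zero    p≢q off =
    trans (∙-cong refl (sum-single (f ∘ suc) p (λ m m≢p → off (suc m) (m≢p ∘ FinP.suc-injective) (λ ()))))
          (comm _ _)
  sum-pair f (suc p) (suc q) p≢q off =
    trans (∙-cong (off zero (λ ()) (λ ()))
                  (sum-pair (f ∘ suc) p q (p≢q ∘ ≡.cong suc)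
                     (λ m m≢p m≢q → off (suc m) (m≢p ∘ FinP.suc-injective) (m≢q ∘ FinP.suc-injective))))
          (identityˡ _)

module ExponentVectors where
  open import Data.Nat using (_+_)

  unit : ∀ {n} → Fin n → Exp n
  unit {n} m = updateAt (replicate n 0) m (λ _ → 1)

  raise lower : ∀ {n} → Fin n → Exp n → Exp n
  raise m γ = updateAt γ m suc
  lower m α = updateAt α m pred

  bump : ∀ {n} → Fin n → ℕ → Exp n → Exp n
  bump t a ν = updateAt ν t (a +_)

  zero+ : ∀ {n} (γ : Exp n) → zipWith _+_ (replicate n 0) γ ≡ γ
  zero+ = zipWith-identityˡ (λ _ → ≡.refl)

  +-assocᵛ : ∀ {n} (α β γ : Exp n) → zipWith _+_ (zipWith _+_ α β) γ ≡ zipWith _+_ α (zipWith _+_ β γ)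
  +-assocᵛ = zipWith-assoc ℕP.+-assoc

  unit+ : ∀ {n} (m : Fin n) (γ : Exp n) → zipWith _+_ (unit m) γ ≡ raise m γ
  unit+ zero    (x Vec.∷ γ) = ≡.cong (suc x Vec.∷_) (zero+ γ)
  unit+ (suc m) (x Vec.∷ γ) = ≡.cong (x Vec.∷_) (unit+ m γ)

  lookup-ext : ∀ {n} (u v : Exp n) → (∀ m → lookup u m ≡ lookup v m) → u ≡ v
  lookup-ext u v same =
    ≡.trans (≡.sym (tabulate∘lookup u)) (≡.trans (tabulate-cong same) (tabulate∘lookup v))

  raise-not-on-face : ∀ {n} (m : Fin n) γ α → lookup α m ≡ 0 → raise m γ ≢ α
  raise-not-on-face m γ α αₘ≡0 eq with () ← ≡.trans (≡.sym αₘ≡0)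
    (≡.trans (≡.cong (λ v → lookup v m) (≡.sym eq)) (lookup∘updateAt m γ))

  raise⇒lower : ∀ {n} (m : Fin n) γ α → raise m γ ≡ α → γ ≡ lower m α
  raise⇒lower m γ α eq =
    ≡.trans (≡.sym (≡.trans (updateAt-updateAt m γ) (updateAt-id m γ))) (≡.cong (lower m) eq)

  lower⇒raise : ∀ {n} (m : Fin n) γ α {p} → lookup α m ≡ suc p → γ ≡ lower m α → raise m γ ≡ α
  lower⇒raise m γ α αₘ≡suc ≡.refl =
    ≡.trans (updateAt-updateAt m α)
            (updateAt-id-local m α (≡.trans (≡.cong (λ k → suc (pred k)) αₘ≡suc) (≡.sym αₘ≡suc)))

  bump-zero : ∀ {n} (t : Fin n) ν → bump t 0 ν ≡ ν
  bump-zero t ν = updateAt-id t ν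

  raise-bump : ∀ {n} (t : Fin n) a ν → raise t (bump t a ν) ≡ bump t (suc a) ν
  raise-bump t a ν = updateAt-updateAt t ν

  weight : ∀ {n} → Fin n → ℕ → Fin n → ℕ
  weight t a m with t Fin.≟ m
  ... | yes _ = a
  ... | no  _ = 0

  weight-self : ∀ {n} (t : Fin n) a → weight t a t ≡ a
  weight-self t a with t Fin.≟ t
  ... | yes _  = ≡.refl
  ... | no t≢t = ⊥-elim (t≢t ≡.refl)

  weight-other : ∀ {n} (t : Fin n) a m → t ≢ m → weight t a m ≡ 0
  weight-other t a m t≢m with t Fin.≟ m
  ... | yes t≡m = ⊥-elim (t≢m t≡m)
  ... | no  _   = ≡.refl

  lookup-bump : ∀ {n} (t : Fin n) a ν m → lookup (bump t a ν) m ≡ weight t a m + lookup ν m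
  lookup-bump t a ν m with t Fin.≟ m
  ... | yes ≡.refl = lookup∘updateAt t ν
  ... | no  t≢m    = lookup∘updateAt′ m t (t≢m ∘ ≡.sym) ν

-- Coefficient calculus for the list representation of polynomials:
-- everything is phrased through `coeff`, since the representation itself
-- is not normalised.
module Coefficients {c ℓ} (F : Field c ℓ) (n : ℕ) where
  open Field F
  open Poly F n
  open ExponentVectors
  open FiniteSums +-commutativeMonoid
  open import Relation.Binary.Reasoning.Setoid setoid

  _·ₜ_ : Carrier × Exp n → Carrier × Exp n → Carrier × Exp n
  (a , β) ·ₜ (b , γ) = (a * b , zipWith ℕ._+_ β γ)

  coeff-++ : ∀ p q α → coeff (p ++ q) α ≈ coeff p α + coeff q α
  coeff-++ []            q α = sym (+-identityˡ _)
  coeff-++ ((a , β) ∷ p) q α with ≡-dec ℕ._≟_ β α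
  ... | yes _ = trans (+-congˡ (coeff-++ p q α)) (sym (+-assoc _ _ _))
  ... | no  _ = coeff-++ p q α

  coeff-∷-cong : ∀ {a a' β β'} p q α → a ≈ a' → β ≡ β' → coeff p α ≈ coeff q α →
                 coeff ((a , β) ∷ p) α ≈ coeff ((a' , β') ∷ q) α
  coeff-∷-cong {β = β} p q α a≈a' ≡.refl p≈q with ≡-dec ℕ._≟_ β α
  ... | yes _ = +-cong a≈a' p≈q
  ... | no  _ = p≈q

  coeff-scale : ∀ k p α → coeff (scale k p) α ≈ k * coeff p α
  coeff-scale k []            α = sym (zeroʳ k)
  coeff-scale k ((a , β) ∷ p) α with ≡-dec ℕ._≟_ β α
  ... | yes _ = trans (+-congˡ (coeff-scale k p α)) (sym (distribˡ k a _))
  ... | no  _ = coeff-scale k p α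

  ⊗-distribʳ-++ : ∀ p q r → (p ++ q) ⊗ r ≡ (p ⊗ r) ++ (q ⊗ r)
  ⊗-distribʳ-++ []      q r = ≡.refl
  ⊗-distribʳ-++ (t ∷ p) q r =
    ≡.trans (≡.cong (map (t ·ₜ_) r ++_) (⊗-distribʳ-++ p q r))
            (≡.sym (++-assoc (map (t ·ₜ_) r) (p ⊗ r) (q ⊗ r)))

  ⊗-assoc : ∀ p q r α → coeff ((p ⊗ q) ⊗ r) α ≈ coeff (p ⊗ (q ⊗ r)) α
  ⊗-assoc []      q r α = refl
  ⊗-assoc (s ∷ p) q r α = begin
      coeff ((map (s ·ₜ_) q ++ (p ⊗ q)) ⊗ r) α
    ≡⟨ ≡.cong (λ z → coeff z α) (⊗-distribʳ-++ (map (s ·ₜ_) q) (p ⊗ q) r) ⟩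
      coeff ((map (s ·ₜ_) q ⊗ r) ++ ((p ⊗ q) ⊗ r)) α
    ≈⟨ coeff-++ (map (s ·ₜ_) q ⊗ r) _ α ⟩
      coeff (map (s ·ₜ_) q ⊗ r) α + coeff ((p ⊗ q) ⊗ r) α
    ≈⟨ +-cong (term-assoc q) (⊗-assoc p q r α) ⟩
      coeff (map (s ·ₜ_) (q ⊗ r)) α + coeff (p ⊗ (q ⊗ r)) α
    ≈⟨ sym (coeff-++ (map (s ·ₜ_) (q ⊗ r)) _ α) ⟩
      coeff (map (s ·ₜ_) (q ⊗ r) ++ (p ⊗ (q ⊗ r))) α ∎
    where
    terms-assoc : ∀ u r → coeff (map ((s ·ₜ u) ·ₜ_) r) α ≈ coeff (map (s ·ₜ_) (map (u ·ₜ_) r)) α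
    terms-assoc u []      = refl
    terms-assoc u (v ∷ r) =
      coeff-∷-cong _ _ α (*-assoc _ _ _) (+-assocᵛ (proj₂ s) (proj₂ u) (proj₂ v)) (terms-assoc u r)
    term-assoc : ∀ q → coeff (map (s ·ₜ_) q ⊗ r) α ≈ coeff (map (s ·ₜ_) (q ⊗ r)) α
    term-assoc []      = refl
    term-assoc (u ∷ q) = begin
        coeff (map ((s ·ₜ u) ·ₜ_) r ++ (map (s ·ₜ_) q ⊗ r)) α
      ≈⟨ coeff-++ (map ((s ·ₜ u) ·ₜ_) r) _ α ⟩
        coeff (map ((s ·ₜ u) ·ₜ_) r) α + coeff (map (s ·ₜ_) q ⊗ r) α
      ≈⟨ +-cong (terms-assoc u r) (term-assoc q) ⟩
        coeff (map (s ·ₜ_) (map (u ·ₜ_) r)) α + coeff (map (s ·ₜ_) (q ⊗ r)) α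
      ≈⟨ sym (coeff-++ (map (s ·ₜ_) (map (u ·ₜ_) r)) _ α) ⟩
        coeff (map (s ·ₜ_) (map (u ·ₜ_) r) ++ map (s ·ₜ_) (q ⊗ r)) α
      ≡⟨ ≡.cong (λ z → coeff z α) (≡.sym (map-++ (s ·ₜ_) (map (u ·ₜ_) r) (q ⊗ r))) ⟩
        coeff (map (s ·ₜ_) (map (u ·ₜ_) r ++ (q ⊗ r))) α ∎

  const1-⊗ : ∀ q α → coeff (const 1# ⊗ q) α ≈ coeff q α
  const1-⊗ q α = trans (coeff-++ (map ((1# , replicate n 0) ·ₜ_) q) [] α)
                       (trans (+-identityʳ _) (unit-terms q))
    where
    unit-terms : ∀ q → coeff (map ((1# , replicate n 0) ·ₜ_) q) α ≈ coeff q α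
    unit-terms []            = refl
    unit-terms ((b , γ) ∷ q) = coeff-∷-cong _ _ α (*-identityˡ b) (zero+ γ) (unit-terms q)

  generator∈ideal : ∀ {g} (G : Poly → Set g) f → G f → InIdeal G f
  generator∈ideal G f Gf =
    ((const 1# , (f , Gf)) ∷ []) ,
    λ α → sym (trans (coeff-++ (const 1# ⊗ f) [] α) (trans (+-identityʳ _) (const1-⊗ f α)))

  -- The coefficient of x_m · Q at α: that of Q at α − e_m, or 0 when α_m = 0.
  coeffBelow : Fin n → Poly → Exp n → Carrier
  coeffBelow m Q α with lookup α m
  ... | zero  = 0#
  ... | suc _ = coeff Q (lower m α)

  coeffBelow-face : ∀ m Q α → lookup α m ≡ 0 → coeffBelow m Q α ≈ 0#
  coeffBelow-face m Q α αₘ≡0 with lookup α m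
  coeffBelow-face m Q α ≡.refl | zero = refl

  coeff-termₘ⊗ : ∀ k m Q α → coeff (map ((k , unit m) ·ₜ_) Q) α ≈ k * coeffBelow m Q α
  coeff-termₘ⊗ k m Q α with lookup α m in αₘ
  ... | zero  = trans (on-face Q) (sym (zeroʳ k))
    where
    on-face : ∀ Q → coeff (map ((k , unit m) ·ₜ_) Q) α ≈ 0#
    on-face []            = refl
    on-face ((b , γ) ∷ Q) with ≡-dec ℕ._≟_ (zipWith ℕ._+_ (unit m) γ) α
    ... | yes eq = ⊥-elim (raise-not-on-face m γ α αₘ (≡.trans (≡.sym (unit+ m γ)) eq))
    ... | no  _  = on-face Q
  ... | suc _ = off-face Q
    where
    off-face : ∀ Q → coeff (map ((k , unit m) ·ₜ_) Q) α ≈ k * coeff Q (lower m α)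
    off-face []            = sym (zeroʳ k)
    off-face ((b , γ) ∷ Q)
      with ≡-dec ℕ._≟_ (zipWith ℕ._+_ (unit m) γ) α | ≡-dec ℕ._≟_ γ (lower m α)
    ... | yes _  | yes _ = trans (+-congˡ (off-face Q)) (sym (distribˡ k b _))
    ... | yes eq | no ne = ⊥-elim (ne (raise⇒lower m γ α (≡.trans (≡.sym (unit+ m γ)) eq)))
    ... | no ne  | yes e = ⊥-elim (ne (≡.trans (unit+ m γ) (lower⇒raise m γ α αₘ e)))
    ... | no _   | no _  = off-face Q

  -- the linear form ∑ₘ aₘ xₘ; the substituted variables (x g)_k are of this shape
  linearForm : (Fin n → Carrier) → Poly
  linearForm a = sumP (map (λ m → scale (a m) (var m)) (allFin n))

  coeff-linearForm⊗ : ∀ a Q α → coeff (linearForm a ⊗ Q) α ≈ sum (λ m → a m * coeffBelow m Q α)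
  coeff-linearForm⊗ a Q α =
    trans (over (allFin n)) (reflexive (foldr-allFin (λ m → a m * coeffBelow m Q α)))
    where
    over : ∀ ms → coeff (sumP (map (λ m → scale (a m) (var m)) ms) ⊗ Q) α
                  ≈ foldr _+_ 0# (map (λ m → a m * coeffBelow m Q α) ms)
    over []       = refl
    over (m ∷ ms) = begin
        coeff ((scale (a m) (var m) ++ rest) ⊗ Q) α
      ≡⟨ ≡.cong (λ z → coeff z α) (⊗-distribʳ-++ (scale (a m) (var m)) rest Q) ⟩
        coeff ((scale (a m) (var m) ⊗ Q) ++ (rest ⊗ Q)) α
      ≈⟨ coeff-++ (scale (a m) (var m) ⊗ Q) _ α ⟩
        coeff (map ((a m * 1# , unit m) ·ₜ_) Q ++ []) α + coeff (rest ⊗ Q) α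
      ≈⟨ +-cong (trans (coeff-++ (map ((a m * 1# , unit m) ·ₜ_) Q) [] α) (+-identityʳ _)) (over ms) ⟩
        coeff (map ((a m * 1# , unit m) ·ₜ_) Q) α + foldr _+_ 0# (map (λ m → a m * coeffBelow m Q α) ms)
      ≈⟨ +-congʳ (trans (coeff-termₘ⊗ _ m Q α) (*-congʳ (*-identityʳ _))) ⟩
        a m * coeffBelow m Q α + foldr _+_ 0# (map (λ m → a m * coeffBelow m Q α) ms) ∎
      where rest = sumP (map (λ m → scale (a m) (var m)) ms)

  indicator : Exp n → Exp n → Carrier
  indicator ν α with ≡-dec ℕ._≟_ ν α
  ... | yes _ = 1#
  ... | no  _ = 0#

  indicator-refl : ∀ α → indicator α α ≈ 1#
  indicator-refl α with ≡-dec ℕ._≟_ α α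
  ... | yes _  = refl
  ... | no α≢α = ⊥-elim (α≢α ≡.refl)

  -- A monomial ideal K with x^λ ∉ K: since K is spanned by monomials
  -- divisible by generators, every element of K has zero coefficient at λ.
  standard-coeff-vanishes : ∀ {s} (S : Exp n → Set s) λ' → ¬ MonomialIdeal S (monomial λ') →
                            ∀ p → MonomialIdeal S p → coeff p λ' ≈ 0#
  standard-coeff-vanishes S λ' λ'∉K p (combo , p≋combo) = trans (p≋combo λ') (combination combo)
    where
    -- x^γ · x^β = x^λ would put x^λ into K
    multiple : ∀ q β → S β → coeff (q ⊗ monomial β) λ' ≈ 0#
    multiple []            β Sβ = refl
    multiple ((a , γ) ∷ q) β Sβ with ≡-dec ℕ._≟_ (zipWith ℕ._+_ γ β) λ'
    ... | yes γ+β≡λ = ⊥-elim (λ'∉K (((monomial γ , (monomial β , (β , Sβ , ≡.refl))) ∷ []) ,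
                                    λ α → coeff-∷-cong [] [] α (sym (*-identityˡ 1#)) (≡.sym γ+β≡λ) refl))
    ... | no  _     = multiple q β Sβ
    combination : ∀ combo → coeff (sumP (map (λ t → proj₁ t ⊗ proj₁ (proj₂ t)) combo)) λ' ≈ 0#
    combination []                                          = refl
    combination ((q , (.(monomial β) , (β , Sβ , ≡.refl))) ∷ combo) =
      trans (coeff-++ (q ⊗ monomial β) _ λ')
            (trans (+-cong (multiple q β Sβ) (combination combo)) (+-identityʳ 0#))

-- These form a one-parameter group, so T(1) is invertible, and T(1) is
-- upper triangular when j < i: it lies in the Borel group.
module Transvections {c ℓ} (F : Field c ℓ) (n : ℕ) (i j : Fin n) (j≢i : j ≢ i) where
  open Field F
  open Poly F n
  open FiniteSums +-commutativeMonoid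
  open import Relation.Binary.Reasoning.Setoid setoid

  identity-diag : ∀ a → identity a a ≈ 1#
  identity-diag a with a Fin.≟ a
  ... | yes _  = refl
  ... | no a≢a = ⊥-elim (a≢a ≡.refl)

  identity-off : ∀ a b → a ≢ b → identity a b ≈ 0#
  identity-off a b a≢b with a Fin.≟ b
  ... | yes a≡b = ⊥-elim (a≢b a≡b)
  ... | no  _   = refl

  E : Matrix
  E a b = identity a j * identity i b

  E-row : ∀ a b → a ≢ j → E a b ≈ 0#
  E-row a b a≢j = trans (*-congʳ (identity-off a j a≢j)) (zeroˡ _)

  E-column : ∀ a b → b ≢ i → E a b ≈ 0#
  E-column a b b≢i = trans (*-congˡ (identity-off i b (b≢i ∘ ≡.sym))) (zeroʳ _)

  E-ji : E j i ≈ 1#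
  E-ji = trans (*-cong (identity-diag j) (identity-diag i)) (*-identityˡ 1#)

  transvection : Carrier → Matrix
  transvection x a b = identity a b + x * E a b

  transvection-row : ∀ x a b → a ≢ j → transvection x a b ≈ identity a b
  transvection-row x a b a≢j = trans (+-congˡ (trans (*-congˡ (E-row a b a≢j)) (zeroʳ x))) (+-identityʳ _)

  transvection-off : ∀ x a b → a ≢ b → b ≢ i → transvection x a b ≈ 0#
  transvection-off x a b a≢b b≢i =
    trans (+-cong (identity-off a b a≢b) (trans (*-congˡ (E-column a b b≢i)) (zeroʳ x))) (+-identityʳ 0#)

  -- T(x) T(y) = T(x + y), since E_{ji}² = 0
  transvection-mul : ∀ x y → (transvection x ·ᴹ transvection y) ≈ᴹ transvection (x + y)
  transvection-mul x y a b = row a (a Fin.≟ j)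
    where
    product : ∀ a → (transvection x ·ᴹ transvection y) a b ≈ sum (λ m → transvection x a m * transvection y m b)
    product a = reflexive (foldr-allFin (λ m → transvection x a m * transvection y m b))
    row : ∀ a → Dec (a ≡ j) → (transvection x ·ᴹ transvection y) a b ≈ transvection (x + y) a b
    row a (no a≢j) = begin
        (transvection x ·ᴹ transvection y) a b
      ≈⟨ product a ⟩
        sum (λ m → transvection x a m * transvection y m b)
      ≈⟨ sum-single _ a (λ m m≢a → trans (*-congʳ (trans (transvection-row x a m a≢j)
                                                         (identity-off a m (m≢a ∘ ≡.sym))))
                                          (zeroˡ _)) ⟩
        transvection x a a * transvection y a b
      ≈⟨ *-cong (trans (transvection-row x a a a≢j) (identity-diag a)) (transvection-row y a b a≢j) ⟩
        1# * identity a b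
      ≈⟨ *-identityˡ _ ⟩
        identity a b
      ≈⟨ sym (transvection-row (x + y) a b a≢j) ⟩
        transvection (x + y) a b ∎
    row .j (yes ≡.refl) = begin
        (transvection x ·ᴹ transvection y) j b
      ≈⟨ product j ⟩
        sum (λ m → transvection x j m * transvection y m b)
      ≈⟨ sum-pair _ j i j≢i (λ m m≢j m≢i → trans (*-congʳ (transvection-off x j m (m≢j ∘ ≡.sym) m≢i))
                                                 (zeroˡ _)) ⟩
        transvection x j j * transvection y j b + transvection x j i * transvection y i b
      ≈⟨ +-cong (trans (*-congʳ diagonal) (*-identityˡ _))
                (*-cong (trans (+-cong (identity-off j i j≢i) (*-congˡ E-ji)) (+-identityˡ _))
                        (transvection-row y i b (j≢i ∘ ≡.sym))) ⟩
        transvection y j b + x * 1# * identity i b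
      ≈⟨ +-congˡ (trans (*-assoc x 1# _) (*-congˡ (sym row-j-of-E))) ⟩
        (identity j b + y * E j b) + x * E j b
      ≈⟨ +-assoc _ _ _ ⟩
        identity j b + (y * E j b + x * E j b)
      ≈⟨ +-congˡ (trans (+-comm _ _) (sym (distribʳ (E j b) x y))) ⟩
        transvection (x + y) j b ∎
      where
      diagonal : transvection x j j ≈ 1#
      diagonal = trans (+-cong (identity-diag j) (trans (*-congˡ (E-column j j j≢i)) (zeroʳ x))) (+-identityʳ 1#)
      row-j-of-E : E j b ≈ 1# * identity i b
      row-j-of-E = *-congʳ (identity-diag j)

  transvection-zero : transvection 0# ≈ᴹ identity
  transvection-zero a b = trans (+-congˡ (zeroˡ _)) (+-identityʳ _)

  transvection-Borel : j Fin.< i → IsBorel (transvection 1#)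
  transvection-Borel j<i = upper , transvection (- 1#) , inverseʳ , inverseˡ
    where
    upper : UpperTriangular (transvection 1#)
    upper a b b<a with b Fin.≟ i
    ... | no b≢i     = transvection-off 1# a b (FinP.<⇒≢ b<a ∘ ≡.sym) b≢i
    ... | yes ≡.refl = trans (transvection-row 1# a b a≢j) (identity-off a b (FinP.<⇒≢ b<a ∘ ≡.sym))
      where
      a≢j : a ≢ j
      a≢j ≡.refl = FinP.<-asym j<i b<a
    inverseʳ : (transvection 1# ·ᴹ transvection (- 1#)) ≈ᴹ identity
    inverseʳ a b = trans (transvection-mul 1# (- 1#) a b)
                         (trans (+-congˡ (*-congʳ (-‿inverseʳ 1#))) (transvection-zero a b))
    inverseˡ : (transvection (- 1#) ·ᴹ transvection 1#) ≈ᴹ identity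
    inverseˡ a b = trans (transvection-mul (- 1#) 1# a b)
                         (trans (+-congˡ (*-congʳ (-‿inverseˡ 1#))) (transvection-zero a b))

-- The action of T = T(1) on a monomial, read off on the face α_i = 0.
-- Substituting x_i ↦ x_i + x_j, the only terms of ᵀ(x^μ) without x_i come
-- from choosing x_j in every factor (x_i + x_j); so on that face ᵀ(x^μ)
-- agrees with the single monomial x^ν, where ν moves the exponent of x_i
-- onto x_j. This is tracked factor by factor through the invariant OnFace.
module FaceCoefficients {c ℓ} (F : Field c ℓ) (n : ℕ) (i j : Fin n) (j≢i : j ≢ i) where
  open Field F
  open Poly F n
  open ExponentVectors
  open Coefficients F n
  open Transvections F n i j j≢i
  open FiniteSums +-commutativeMonoid
  open import Relation.Binary.Reasoning.Setoid setoid

  T : Matrix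
  T = transvection 1#

  -- the variable that x_k becomes on the face: x_j for k = i, else x_k
  target : Fin n → Fin n
  target k with k Fin.≟ i
  ... | yes _ = j
  ... | no  _ = k

  target-i : target i ≡ j
  target-i with i Fin.≟ i
  ... | yes _  = ≡.refl
  ... | no i≢i = ⊥-elim (i≢i ≡.refl)

  target-other : ∀ k → k ≢ i → target k ≡ k
  target-other k k≢i with k Fin.≟ i
  ... | yes k≡i = ⊥-elim (k≢i k≡i)
  ... | no  _   = ≡.refl

  target≢i : ∀ k → target k ≢ i
  target≢i k with k Fin.≟ i
  ... | yes _   = j≢i
  ... | no  k≢i = k≢i

  column-target : ∀ k → T (target k) k ≈ 1#
  column-target k with k Fin.≟ i
  ... | yes ≡.refl = trans (+-cong (identity-off j k j≢i) (*-identityˡ _)) (trans (+-identityˡ _) E-ji)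
  ... | no  k≢i    = trans (+-cong (identity-diag k) (trans (*-identityˡ _) (E-column k k k≢i))) (+-identityʳ 1#)

  column-off : ∀ k m → m ≢ target k → m ≢ i → T m k ≈ 0#
  column-off k m m≢t m≢i with k Fin.≟ i
  ... | yes ≡.refl = trans (transvection-row 1# m k m≢t) (identity-off m k m≢i)
  ... | no  k≢i    = transvection-off 1# m k m≢t k≢i

  OnFace : Poly → Exp n → Set ℓ
  OnFace Q ν = ∀ α → lookup α i ≡ 0 → coeff Q α ≈ indicator ν α

  coeffBelow-OnFace : ∀ m Q ν α → m ≢ i → OnFace Q ν → lookup α i ≡ 0 →
                      coeffBelow m Q α ≈ indicator (raise m ν) α
  coeffBelow-OnFace m Q ν α m≢i onFace αᵢ≡0 with lookup α m in αₘ
  ... | zero with ≡-dec ℕ._≟_ (raise m ν) α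
  ...   | yes eq = ⊥-elim (raise-not-on-face m ν α αₘ eq)
  ...   | no  _  = refl
  coeffBelow-OnFace m Q ν α m≢i onFace αᵢ≡0 | suc _ =
    trans (onFace (lower m α) (≡.trans (lookup∘updateAt′ i m (m≢i ∘ ≡.sym) α) αᵢ≡0))
          (same-indicator (≡-dec ℕ._≟_ ν (lower m α)) (≡-dec ℕ._≟_ (raise m ν) α))
    where
    same-indicator : Dec (ν ≡ lower m α) → Dec (raise m ν ≡ α) → indicator ν (lower m α) ≈ indicator (raise m ν) α
    same-indicator _ _ with ≡-dec ℕ._≟_ ν (lower m α) | ≡-dec ℕ._≟_ (raise m ν) α
    ... | yes _  | yes _  = refl
    ... | no _   | no _   = refl
    ... | yes e  | no ne  = ⊥-elim (ne (lower⇒raise m ν α αₘ e))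
    ... | no ne  | yes e  = ⊥-elim (ne (raise⇒lower m ν α e))

  OnFace-step : ∀ k Q ν → OnFace Q ν → OnFace (xg T k ⊗ Q) (raise (target k) ν)
  OnFace-step k Q ν onFace α αᵢ≡0 = begin
      coeff (xg T k ⊗ Q) α
    ≈⟨ coeff-linearForm⊗ (λ m → T m k) Q α ⟩
      sum (λ m → T m k * coeffBelow m Q α)
    ≈⟨ sum-single _ (target k) vanishing ⟩
      T (target k) k * coeffBelow (target k) Q α
    ≈⟨ trans (*-congʳ (column-target k)) (*-identityˡ _) ⟩
      coeffBelow (target k) Q α
    ≈⟨ coeffBelow-OnFace (target k) Q ν α (target≢i k) onFace αᵢ≡0 ⟩
      indicator (raise (target k) ν) α ∎
    where
    vanishing : ∀ m → m ≢ target k → T m k * coeffBelow m Q α ≈ 0#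
    vanishing m m≢t with m Fin.≟ i
    ... | yes ≡.refl = trans (*-congˡ (coeffBelow-face m Q α αᵢ≡0)) (zeroʳ _)
    ... | no  m≢i    = trans (*-congʳ (column-off k m m≢t m≢i)) (zeroˡ _)

  OnFace-power : ∀ k a Q ν → OnFace Q ν → OnFace ((xg T k ^ᵖ a) ⊗ Q) (bump (target k) a ν)
  OnFace-power k zero    Q ν onFace α αᵢ≡0 =
    trans (const1-⊗ Q α) (trans (onFace α αᵢ≡0) (reflexive (≡.cong (λ ν' → indicator ν' α) (≡.sym (bump-zero (target k) ν)))))
  OnFace-power k (suc a) Q ν onFace α αᵢ≡0 =
    trans (⊗-assoc (xg T k) (xg T k ^ᵖ a) Q α)
          (trans (OnFace-step k ((xg T k ^ᵖ a) ⊗ Q) (bump (target k) a ν) (OnFace-power k a Q ν onFace) α αᵢ≡0)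
                 (reflexive (≡.cong (λ ν' → indicator ν' α) (raise-bump (target k) a ν))))

  -- the exponent of the face monomial of ∏_{k ∈ ks} (x T)_k^{μ_k}
  pushed : Exp n → List (Fin n) → Exp n
  pushed μ []       = replicate n 0
  pushed μ (k ∷ ks) = bump (target k) (lookup μ k) (pushed μ ks)

  OnFace-product : ∀ μ ks → OnFace (prodP (map (λ k → xg T k ^ᵖ lookup μ k) ks)) (pushed μ ks)
  OnFace-product μ []       α αᵢ≡0 with ≡-dec ℕ._≟_ (replicate n 0) α
  ... | yes _ = +-identityʳ 1#
  ... | no  _ = refl
  OnFace-product μ (k ∷ ks) = OnFace-power k (lookup μ k) _ (pushed μ ks) (OnFace-product μ ks)

  OnFace-act : ∀ μ → OnFace (act T (monomial μ)) (pushed μ (allFin n))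
  OnFace-act μ α αᵢ≡0 = begin
      coeff (scale 1# P ++ []) α
    ≈⟨ trans (coeff-++ (scale 1# P) [] α) (+-identityʳ _) ⟩
      coeff (scale 1# P) α
    ≈⟨ trans (coeff-scale 1# P α) (*-identityˡ _) ⟩
      coeff P α
    ≈⟨ OnFace-product μ (allFin n) α αᵢ≡0 ⟩
      indicator (pushed μ (allFin n)) α ∎
    where P = prodP (map (λ k → xg T k ^ᵖ lookup μ k) (allFin n))

  module ℕSums = FiniteSums ℕP.+-0-commutativeMonoid

  lookup-pushed : ∀ μ ks m →
    lookup (pushed μ ks) m ≡ foldr ℕ._+_ 0 (map (λ k → weight (target k) (lookup μ k) m) ks)
  lookup-pushed μ []       m = lookup-replicate m 0
  lookup-pushed μ (k ∷ ks) m =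
    ≡.trans (lookup-bump (target k) (lookup μ k) (pushed μ ks) m)
            (≡.cong (weight (target k) (lookup μ k) m ℕ.+_) (lookup-pushed μ ks m))

  lookup-pushed-all : ∀ μ m →
    lookup (pushed μ (allFin n)) m ≡ ℕSums.sum (λ k → weight (target k) (lookup μ k) m)
  lookup-pushed-all μ m =
    ≡.trans (lookup-pushed μ (allFin n) m) (ℕSums.foldr-allFin (λ k → weight (target k) (lookup μ k) m))

  pushed-i : ∀ μ → lookup (pushed μ (allFin n)) i ≡ 0
  pushed-i μ = ≡.trans (lookup-pushed-all μ i)
                       (ℕSums.sum-zero _ (λ k → weight-other (target k) _ i (target≢i k)))

  pushed-j : ∀ μ → lookup (pushed μ (allFin n)) j ≡ lookup μ j ℕ.+ lookup μ i
  pushed-j μ = ≡.trans (lookup-pushed-all μ j)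
    (≡.trans (ℕSums.sum-pair _ j i j≢i off)
             (≡.cong₂ ℕ._+_ (≡.trans (≡.cong (λ t → weight t (lookup μ j) j) (target-other j j≢i)) (weight-self j _))
                            (≡.trans (≡.cong (λ t → weight t (lookup μ i) j) target-i) (weight-self j _))))
    where
    off : ∀ k → k ≢ j → k ≢ i → weight (target k) (lookup μ k) j ≡ 0
    off k k≢j k≢i = weight-other (target k) _ j (λ t≡j → k≢j (≡.trans (≡.sym (target-other k k≢i)) t≡j))

  pushed-other : ∀ μ m → m ≢ i → m ≢ j → lookup (pushed μ (allFin n)) m ≡ lookup μ m
  pushed-other μ m m≢i m≢j = ≡.trans (lookup-pushed-all μ m)
    (≡.trans (ℕSums.sum-single _ m off)
             (≡.trans (≡.cong (λ t → weight t (lookup μ m) m) (target-other m m≢i)) (weight-self m _)))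
    where
    off : ∀ k → k ≢ m → weight (target k) (lookup μ k) m ≡ 0
    off k k≢m = weight-other (target k) _ m (target-avoids (k Fin.≟ i))
      where
      target-avoids : Dec (k ≡ i) → target k ≢ m
      target-avoids (yes ≡.refl) t≡m = m≢j (≡.trans (≡.sym t≡m) target-i)
      target-avoids (no k≢i)     t≡m = k≢m (≡.trans (≡.sym (target-other k k≢i)) t≡m)

  pushed-shift : ∀ λ' l → lookup λ' i ≡ 0 → l ℕ.≤ lookup λ' j → pushed (shift λ' i j l) (allFin n) ≡ λ'
  pushed-shift λ' l λ'ᵢ≡0 l≤λ'ⱼ = lookup-ext _ λ' entry
    where
    μ₀ μ : Exp n
    μ₀ = updateAt λ' j (ℕ._∸ l)
    μ = shift λ' i j l
    entry : ∀ m → lookup (pushed μ (allFin n)) m ≡ lookup λ' m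
    entry m with m Fin.≟ i | m Fin.≟ j
    ... | yes ≡.refl | _ = ≡.trans (pushed-i μ) (≡.sym λ'ᵢ≡0)
    ... | no m≢i | yes ≡.refl =
      ≡.trans (pushed-j μ) (≡.trans (≡.cong₂ ℕ._+_ μⱼ μᵢ) (ℕP.m∸n+n≡m l≤λ'ⱼ))
      where
      μⱼ : lookup μ j ≡ lookup λ' j ℕ.∸ l
      μⱼ = ≡.trans (lookup∘updateAt′ j i j≢i μ₀) (lookup∘updateAt j λ')
      μᵢ : lookup μ i ≡ l
      μᵢ = ≡.trans (lookup∘updateAt i μ₀)
                   (≡.cong (ℕ._+ l) (≡.trans (lookup∘updateAt′ i j (j≢i ∘ ≡.sym) λ') λ'ᵢ≡0))
    ... | no m≢i | no m≢j = ≡.trans (pushed-other μ m m≢i m≢j)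
      (≡.trans (lookup∘updateAt′ m i m≢i μ₀) (lookup∘updateAt′ m j m≢j λ'))

lemma5p4 : ∀ {c ℓ s : Level} (F : Field c ℓ) (n : ℕ) (S : Exp n → Set s) →
    let open Poly F n in
    BorelStable (MonomialIdeal S) →
    FiniteDimQuotient (MonomialIdeal S) →
    BorelExchange n (λ λ' → ¬ MonomialIdeal S (monomial λ'))
lemma5p4 F n S stable _ j i j<i λ' λ'∉K λ'ᵢ≡0 l l≤λ'ⱼ μ∈K = 1≉0 (begin
    1#                                 ≈⟨ sym (indicator-refl λ') ⟩
    indicator λ' λ'                    ≡⟨ ≡.cong (λ ν → indicator ν λ') (≡.sym (pushed-shift λ' l λ'ᵢ≡0 l≤λ'ⱼ)) ⟩
    indicator (pushed μ (allFin n)) λ' ≈⟨ sym (OnFace-act μ λ' λ'ᵢ≡0) ⟩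
    coeff (act T (monomial μ)) λ'      ≈⟨ standard-coeff-vanishes S λ' λ'∉K (act T (monomial μ)) Tμ∈K ⟩
    0#                                 ∎)
  where
  open Field F
  open Poly F n
  open Coefficients F n
  open Transvections F n i j (FinP.<⇒≢ j<i)
  open FaceCoefficients F n i j (FinP.<⇒≢ j<i)
  open import Relation.Binary.Reasoning.Setoid setoid
  μ : Exp n
  μ = shift λ' i j l
  -- ᵀ(x^μ) ∈ ᵀK = K
  Tμ∈K : MonomialIdeal S (act T (monomial μ))
  Tμ∈K = proj₁ (stable T (transvection-Borel j<i) (act T (monomial μ)))
               (generator∈ideal _ (act T (monomial μ)) (monomial μ , μ∈K , ≡.refl))
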